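{- For positive integers $n>k\ge t$ we have $$\binom{n-t}{k-t}+(k-t)t\binom{n-k}{k-t}+\sum_{i=0}^{t-1}\binom{k}{i}\binom{n-k}{k-i}\le\binom{n}{k}.$$
   Context: Binomial coefficients follow the convention $\binom{a}{b}=0$ whenever $b<0$ or $b>a$. -}

module Defs where

open import Data.Nat using (ℕ; zero; suc; _+_)

Σ< : ℕ → (ℕ → ℕ) → ℕ
Σ< zero    f = 0
Σ< (suc n) f = Σ< n f + f n

-- Write k = t + a and n = k + m. By Vandermonde, (n C k) = Σ_{i ≤ k} (k C i)(m C (k − i)); the
-- terms with i < t are exactly the sum in the statement, and the remaining ones, indexed by
-- i = t + j, dominate the terms (a C j)(m C (a − j)) of the Vandermonde expansion of
-- (n − t) C (k − t) = (a + m) C a. At j = 0 there is room to spare: (t + a) C t ≥ 1 + a t,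
-- which absorbs the middle term a t (m C a).
module Submission where

open import Defs
open import Data.Nat using (ℕ; zero; suc; _+_; _*_; _∸_; _≤_; _<_; z≤n; s≤s)
open import Data.Nat.Properties
open import Data.Nat.Combinatorics using (_C_; nCk+nC[k+1]≡[n+1]C[k+1]; nCn≡1; nCk≡nC[n∸k]; k>n⇒nCk≡0)
open import Data.Nat.Tactic.RingSolver using (solve-∀)
open import Data.Product using (_,_)
open import Relation.Binary.PropositionalEquality
open import Algebra.Properties.CommutativeSemigroup +-commutativeSemigroup using (x∙yz≈y∙xz; xy∙z≈xz∙y)

Σ<-cong : ∀ n {f g : ℕ → ℕ} → (∀ i → f i ≡ g i) → Σ< n f ≡ Σ< n g
Σ<-cong zero    f≡g = refl
Σ<-cong (suc n) f≡g = cong₂ _+_ (Σ<-cong n f≡g) (f≡g n)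

Σ<-mono-≤ : ∀ n {f g : ℕ → ℕ} → (∀ i → f i ≤ g i) → Σ< n f ≤ Σ< n g
Σ<-mono-≤ zero    f≤g = ≤-refl
Σ<-mono-≤ (suc n) f≤g = +-mono-≤ (Σ<-mono-≤ n f≤g) (f≤g n)

Σ<-zero : ∀ n → Σ< n (λ _ → 0) ≡ 0
Σ<-zero zero    = refl
Σ<-zero (suc n) = trans (+-identityʳ _) (Σ<-zero n)

Σ<-distrib-+ : ∀ n (f g : ℕ → ℕ) → Σ< n (λ i → f i + g i) ≡ Σ< n f + Σ< n g
Σ<-distrib-+ zero    f g = refl
Σ<-distrib-+ (suc n) f g = begin
  Σ< n (λ i → f i + g i) + (f n + g n) ≡⟨ cong (_+ (f n + g n)) (Σ<-distrib-+ n f g) ⟩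
  Σ< n f + Σ< n g + (f n + g n)         ≡⟨ +-assoc (Σ< n f) _ _ ⟩
  Σ< n f + (Σ< n g + (f n + g n))       ≡⟨ cong (Σ< n f +_) (x∙yz≈y∙xz (Σ< n g) (f n) (g n)) ⟩
  Σ< n f + (f n + (Σ< n g + g n))       ≡⟨ +-assoc (Σ< n f) _ _ ⟨
  Σ< n f + f n + (Σ< n g + g n)         ∎
  where open ≡-Reasoning

Σ<-suc : ∀ n (f : ℕ → ℕ) → Σ< (suc n) f ≡ f 0 + Σ< n (λ i → f (suc i))
Σ<-suc zero    f = +-comm 0 (f 0)
Σ<-suc (suc n) f = trans (cong (_+ f (suc n)) (Σ<-suc n f)) (+-assoc (f 0) _ _)

Σ<-split : ∀ m n (f : ℕ → ℕ) → Σ< (m + n) f ≡ Σ< m f + Σ< n (λ j → f (m + j))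
Σ<-split m zero    f rewrite +-identityʳ m = sym (+-identityʳ _)
Σ<-split m (suc n) f rewrite +-suc m n =
  trans (cong (_+ f (m + n)) (Σ<-split m n f)) (+-assoc (Σ< m f) _ _)

Σ<-mono-≤-with-slack : ∀ n (f g : ℕ → ℕ) c →
  f 0 + c ≤ g 0 → (∀ i → f (suc i) ≤ g (suc i)) → Σ< (suc n) f + c ≤ Σ< (suc n) g
Σ<-mono-≤-with-slack n f g c f₀+c≤g₀ f≤g = begin
  Σ< (suc n) f + c                       ≡⟨ cong (_+ c) (Σ<-suc n f) ⟩
  f 0 + Σ< n (λ i → f (suc i)) + c       ≡⟨ xy∙z≈xz∙y (f 0) _ c ⟩
  f 0 + c + Σ< n (λ i → f (suc i))       ≤⟨ +-mono-≤ f₀+c≤g₀ (Σ<-mono-≤ n f≤g) ⟩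
  g 0 + Σ< n (λ i → g (suc i))           ≡⟨ Σ<-suc n g ⟨
  Σ< (suc n) g                           ∎
  where open ≤-Reasoning

nC0≡1 : ∀ n → n C 0 ≡ 1
nC0≡1 n = trans (nCk≡nC[n∸k] {0} {n} z≤n) (nCn≡1 n)

0C[1+k]≡0 : ∀ k → 0 C suc k ≡ 0
0C[1+k]≡0 k = k>n⇒nCk≡0 (s≤s (z≤n {k}))

[n+1]C[k+1]≡nCk+nC[k+1] : ∀ n k → suc n C suc k ≡ n C k + n C suc k
[n+1]C[k+1]≡nCk+nC[k+1] n k = sym (nCk+nC[k+1]≡[n+1]C[k+1] n k)

vandermonde : ∀ p q r → (p + q) C r ≡ Σ< (suc r) (λ i → (p C i) * (q C (r ∸ i)))
vandermonde zero q r = sym (begin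
  Σ< (suc r) (λ i → (0 C i) * (q C (r ∸ i)))
    ≡⟨ Σ<-suc r _ ⟩
  1 * (q C r) + Σ< r (λ i → (0 C suc i) * (q C (r ∸ suc i)))
    ≡⟨ cong₂ _+_ (*-identityˡ (q C r))
             (trans (Σ<-cong r (λ i → cong (_* (q C (r ∸ suc i))) (0C[1+k]≡0 i))) (Σ<-zero r)) ⟩
  q C r + 0
    ≡⟨ +-identityʳ (q C r) ⟩
  q C r ∎)
  where open ≡-Reasoning
vandermonde (suc p) q zero =
  trans (nC0≡1 (suc p + q)) (sym (cong₂ _*_ (nC0≡1 (suc p)) (nC0≡1 q)))
vandermonde (suc p) q (suc r) = begin
  suc (p + q) C suc r
    ≡⟨ [n+1]C[k+1]≡nCk+nC[k+1] (p + q) r ⟩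
  (p + q) C r + (p + q) C suc r
    ≡⟨ cong₂ _+_ (vandermonde p q r) (trans (vandermonde p q (suc r)) (Σ<-suc (suc r) _)) ⟩
  S₀ + ((p C 0) * (q C suc r) + S₁)
    ≡⟨ x∙yz≈y∙xz S₀ ((p C 0) * (q C suc r)) S₁ ⟩
  (p C 0) * (q C suc r) + (S₀ + S₁)
    ≡⟨ cong₂ _+_ (cong (_* (q C suc r)) (trans (nC0≡1 p) (sym (nC0≡1 (suc p))))) pascal-sum ⟩
  (suc p C 0) * (q C suc r) + Σ< (suc r) (λ i → (suc p C suc i) * (q C (r ∸ i)))
    ≡⟨ Σ<-suc (suc r) (λ i → (suc p C i) * (q C (suc r ∸ i))) ⟨
  Σ< (suc (suc r)) (λ i → (suc p C i) * (q C (suc r ∸ i))) ∎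
  where
  open ≡-Reasoning
  S₀ = Σ< (suc r) (λ i → (p C i) * (q C (r ∸ i)))
  S₁ = Σ< (suc r) (λ i → (p C suc i) * (q C (r ∸ i)))
  pascal-sum : S₀ + S₁ ≡ Σ< (suc r) (λ i → (suc p C suc i) * (q C (r ∸ i)))
  pascal-sum = sym (trans
    (Σ<-cong (suc r) λ i → trans (cong (_* (q C (r ∸ i))) ([n+1]C[k+1]≡nCk+nC[k+1] p i))
                                 (*-distribʳ-+ (q C (r ∸ i)) (p C i) (p C suc i)))
    (Σ<-distrib-+ (suc r) _ _))

nCk≤[m+n]C[m+k] : ∀ m n k → n C k ≤ (m + n) C (m + k)
nCk≤[m+n]C[m+k] zero    n k = ≤-refl
nCk≤[m+n]C[m+k] (suc m) n k = ≤-trans (nCk≤[m+n]C[m+k] m n k)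
  (≤-trans (m≤m+n _ _) (≤-reflexive (nCk+nC[k+1]≡[n+1]C[k+1] (m + n) (m + k))))

1+a*t≤[t+a]Ct : ∀ t a → 1 + a * t ≤ (t + a) C t
1+a*t≤[t+a]Ct zero    a rewrite *-zeroʳ a | nC0≡1 a = ≤-refl
1+a*t≤[t+a]Ct (suc t) zero rewrite +-identityʳ t = ≤-reflexive (sym (nCn≡1 (suc t)))
1+a*t≤[t+a]Ct (suc t) (suc a) = begin
  1 + suc a * suc t
    ≤⟨ m≤m+n _ (a * t) ⟩
  1 + suc a * suc t + a * t
    ≡⟨ cong suc (rearrange t a) ⟩
  (1 + suc a * t) + (1 + a * suc t)
    ≤⟨ +-mono-≤ (1+a*t≤[t+a]Ct t (suc a)) (1+a*t≤[t+a]Ct (suc t) a) ⟩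
  (t + suc a) C t + (suc t + a) C suc t
    ≡⟨ cong (λ x → (t + suc a) C t + x C suc t) (+-suc t a) ⟨
  (t + suc a) C t + (t + suc a) C suc t
    ≡⟨ nCk+nC[k+1]≡[n+1]C[k+1] (t + suc a) t ⟩
  (suc t + suc a) C suc t ∎
  where
  open ≤-Reasoning
  rearrange : ∀ t a → suc a * suc t + a * t ≡ suc a * t + (1 + a * suc t)
  rearrange = solve-∀

[t+a+m]C[t+a]-lower-bound : ∀ t a m →
  (a + m) C a + a * t * (m C a) + Σ< t (λ i → ((t + a) C i) * (m C (t + a ∸ i)))
    ≤ (t + a + m) C (t + a)
[t+a+m]C[t+a]-lower-bound t a m = begin
  (a + m) C a + a * t * (m C a) + Σ< t h
    ≡⟨ cong (λ x → x + a * t * (m C a) + Σ< t h) (vandermonde a m a) ⟩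
  Σ< (suc a) f + a * t * (m C a) + Σ< t h
    ≤⟨ +-monoˡ-≤ (Σ< t h) (Σ<-mono-≤-with-slack a f (λ j → h (t + j)) _ head-term tail-terms) ⟩
  Σ< (suc a) (λ j → h (t + j)) + Σ< t h
    ≡⟨ +-comm _ (Σ< t h) ⟩
  Σ< t h + Σ< (suc a) (λ j → h (t + j))
    ≡⟨ Σ<-split t (suc a) h ⟨
  Σ< (t + suc a) h
    ≡⟨ cong (λ x → Σ< x h) (+-suc t a) ⟩
  Σ< (suc (t + a)) h
    ≡⟨ vandermonde (t + a) m (t + a) ⟨
  (t + a + m) C (t + a) ∎
  where
  open ≤-Reasoning
  f h : ℕ → ℕ
  f j = (a C j) * (m C (a ∸ j))
  h i = ((t + a) C i) * (m C (t + a ∸ i))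
  h[t+j]≡[t+a]C[t+j]*mC[a∸j] : ∀ j → h (t + j) ≡ ((t + a) C (t + j)) * (m C (a ∸ j))
  h[t+j]≡[t+a]C[t+j]*mC[a∸j] j = cong (((t + a) C (t + j)) *_) (cong (m C_) ([m+n]∸[m+o]≡n∸o t a j))
  head-term : f 0 + a * t * (m C a) ≤ h (t + 0)
  head-term = begin
    (a C 0) * (m C a) + a * t * (m C a)  ≡⟨ cong (λ x → x * (m C a) + a * t * (m C a)) (nC0≡1 a) ⟩
    1 * (m C a) + a * t * (m C a)        ≡⟨ *-distribʳ-+ (m C a) 1 (a * t) ⟨
    (1 + a * t) * (m C a)                ≤⟨ *-monoˡ-≤ (m C a) (1+a*t≤[t+a]Ct t a) ⟩
    ((t + a) C t) * (m C a)              ≡⟨ cong (λ x → ((t + a) C x) * (m C a)) (+-identityʳ t) ⟨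
    ((t + a) C (t + 0)) * (m C a)        ≡⟨ h[t+j]≡[t+a]C[t+j]*mC[a∸j] 0 ⟨
    h (t + 0)                            ∎
  tail-terms : ∀ j → f (suc j) ≤ h (t + suc j)
  tail-terms j = ≤-trans (*-monoˡ-≤ (m C (a ∸ suc j)) (nCk≤[m+n]C[m+k] t a (suc j)))
                         (≤-reflexive (sym (h[t+j]≡[t+a]C[t+j]*mC[a∸j] (suc j))))

lemma2p1 : (n k t : ℕ) → 1 ≤ t → t ≤ k → k < n →
    (n ∸ t) C (k ∸ t) + (k ∸ t) * t * ((n ∸ k) C (k ∸ t))
    + Σ< t (λ i → (k C i) * ((n ∸ k) C (k ∸ i)))
    ≤ n C k
lemma2p1 n k t _ t≤k k<n
  with a , refl ← m≤n⇒∃[o]m+o≡n t≤k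
  with m , refl ← m≤n⇒∃[o]m+o≡n (<⇒≤ k<n)
  = subst (_≤ (t + a + m) C (t + a)) (sym differences-simplify) ([t+a+m]C[t+a]-lower-bound t a m)
  where
  L : ℕ → ℕ → ℕ → ℕ
  L x y z = x C y + y * t * (z C y) + Σ< t (λ i → ((t + a) C i) * (z C (t + a ∸ i)))
  differences-simplify : L (t + a + m ∸ t) (t + a ∸ t) (t + a + m ∸ (t + a)) ≡ L (a + m) a m
  differences-simplify = trans
    (cong₂ (λ x y → L x y (t + a + m ∸ (t + a)))
           (trans (cong (_∸ t) (+-assoc t a m)) (m+n∸m≡n t (a + m))) (m+n∸m≡n t a))
    (cong (L (a + m) a) (m+n∸m≡n (t + a) m))
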